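{- Let $(G,v)$ be an independent Hamel space over an ordered field $C$. Then for all $x_0,y_0,x_1,y_1\in G$ with $x_0<_0y_0$ and $x_1<_1y_1$ there is $z\in G$ such that $z\neq v(z)$, $x_0<_0z<_0y_0$ and $x_1<_1z<_1y_1$.
   Context: A $2$-ordered $C$-vector space is a $C$-vector space $G$ with two linear orders $<_0,<_1$, each making $G$ an ordered $C$-vector space (ordered abelian group with $\lambda>0,x>0\Rightarrow\lambda x>0$ for $\lambda\in C$). Put $G_\infty=G\cup\{\infty\}$ with $\infty$ above $G$ in both orders. A Hamel valuation on $G$ is a map $v:G\to G_\infty$ such that for all $x,y\in G$, $\lambda\in C\setminus\{0\}$: $v(x)=\infty$ iff $x=0$; $v(x+y)\geq_0\min_0(v(x),v(y))$; $v(\lambda x)=v(x)$; if $0<_1x<_1y$ then $v(x)\geq_0v(y)$; $v(v(x))=v(x)$ (with $v(\infty)=\infty$); and $v(x)>_10$. A Hamel space is a pair $(G,v)$ of such; it is independent if for all $a_0,b_0,a_1,b_1\in G\cup\{\pm\infty\}$ with $a_0<_0b_0$, $a_1<_1b_1$ there is $z\in G$ with $a_0<_0z<_0b_0$ and $a_1<_1z<_1b_1$. -}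

module Defs where

open import Level using (Level; _⊔_; suc; Lift)
open import Data.Unit using (⊤)
open import Data.Product using (Σ; _×_; _,_)
open import Data.Sum using (_⊎_)
open import Data.Empty using (⊥)
open import Relation.Nullary using (¬_)
open import Relation.Binary.PropositionalEquality using (_≡_)

record IsStrictLinearOrder {a ℓ} (A : Set a) (_<_ : A → A → Set ℓ) : Set (a ⊔ ℓ) where
  field
    irrefl : ∀ x → ¬ (x < x)
    trans  : ∀ {x y z} → x < y → y < z → x < z
    trich  : ∀ x y → (x < y) ⊎ ((x ≡ y) ⊎ (y < x))

record OrderedField (c ℓ : Level) : Set (Level.suc (c ⊔ ℓ)) where
  infixl 6 _+_
  infixl 7 _*_
  infix 4 _<_
  field
    Carrier : Set c
    _+_ _*_ : Carrier → Carrier → Carrier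
    -_      : Carrier → Carrier
    0# 1#   : Carrier
    _<_     : Carrier → Carrier → Set ℓ
    +-assoc : ∀ x y z → (x + y) + z ≡ x + (y + z)
    +-comm  : ∀ x y → x + y ≡ y + x
    +-idˡ   : ∀ x → 0# + x ≡ x
    -‿invˡ  : ∀ x → (- x) + x ≡ 0#
    *-assoc : ∀ x y z → (x * y) * z ≡ x * (y * z)
    *-comm  : ∀ x y → x * y ≡ y * x
    *-idˡ   : ∀ x → 1# * x ≡ x
    distribˡ : ∀ x y z → x * (y + z) ≡ (x * y) + (x * z)
    0≢1     : ¬ (0# ≡ 1#)
    inverse : ∀ x → ¬ (x ≡ 0#) → Σ Carrier (λ y → y * x ≡ 1#)
    <-isStrictLinearOrder : IsStrictLinearOrder Carrier _<_
    +-mono-< : ∀ {x y} z → x < y → x + z < y + z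
    *-pos    : ∀ {x y} → 0# < x → 0# < y → 0# < x * y

record TwoOrderedVectorSpace {c ℓ} (C : OrderedField c ℓ) (g ℓ' : Level)
       : Set (c ⊔ ℓ ⊔ Level.suc (g ⊔ ℓ')) where
  module F = OrderedField C
  infixl 6 _+_
  infixr 7 _·_
  field
    Carrier : Set g
    _+_     : Carrier → Carrier → Carrier
    -_      : Carrier → Carrier
    0#      : Carrier
    _·_     : F.Carrier → Carrier → Carrier
    +-assoc : ∀ x y z → (x + y) + z ≡ x + (y + z)
    +-comm  : ∀ x y → x + y ≡ y + x
    +-idˡ   : ∀ x → 0# + x ≡ x
    -‿invˡ  : ∀ x → (- x) + x ≡ 0#
    ·-distrib-+ : ∀ (λ' : F.Carrier) x y → λ' · (x + y) ≡ (λ' · x) + (λ' · y)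
    ·-distrib-F+ : ∀ (λ' μ : F.Carrier) x → (λ' F.+ μ) · x ≡ (λ' · x) + (μ · x)
    ·-assoc : ∀ (λ' μ : F.Carrier) x → (λ' F.* μ) · x ≡ λ' · (μ · x)
    ·-id    : ∀ x → F.1# · x ≡ x
    _<₀_ _<₁_ : Carrier → Carrier → Set ℓ'
    <₀-isStrictLinearOrder : IsStrictLinearOrder Carrier _<₀_
    <₁-isStrictLinearOrder : IsStrictLinearOrder Carrier _<₁_
    +-mono-<₀ : ∀ {x y} z → x <₀ y → (x + z) <₀ (y + z)
    +-mono-<₁ : ∀ {x y} z → x <₁ y → (x + z) <₁ (y + z)
    ·-pos₀ : ∀ {λ' : F.Carrier} {x} → F.0# F.< λ' → 0# <₀ x → 0# <₀ (λ' · x)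
    ·-pos₁ : ∀ {λ' : F.Carrier} {x} → F.0# F.< λ' → 0# <₁ x → 0# <₁ (λ' · x)

data WithInf {g} (G : Set g) : Set g where
  fin : G → WithInf G
  ∞   : WithInf G

_<∞[_]_ : ∀ {g ℓ} {G : Set g} → WithInf G → (G → G → Set ℓ) → WithInf G → Set ℓ
fin x <∞[ R ] fin y = R x y
fin x <∞[ R ] ∞     = Lift _ ⊤
∞     <∞[ R ] _     = Lift _ ⊥

_≤∞[_]_ : ∀ {g ℓ} {G : Set g} → WithInf G → (G → G → Set ℓ) → WithInf G → Set (g ⊔ ℓ)
a ≤∞[ R ] b = (a <∞[ R ] b) ⊎ (a ≡ b)

data WithPmInf {g} (G : Set g) : Set g where
  -∞  : WithPmInf G
  val : G → WithPmInf G
  +∞  : WithPmInf G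

_<±[_]_ : ∀ {g ℓ} {G : Set g} → WithPmInf G → (G → G → Set ℓ) → WithPmInf G → Set ℓ
val x <±[ R ] val y = R x y
-∞    <±[ R ] val _ = Lift _ ⊤
-∞    <±[ R ] +∞    = Lift _ ⊤
val _ <±[ R ] +∞    = Lift _ ⊤
_     <±[ R ] _     = Lift _ ⊥

module _ {c ℓ g ℓ'} {C : OrderedField c ℓ} (G : TwoOrderedVectorSpace C g ℓ') where
  open TwoOrderedVectorSpace G
  private module K = OrderedField C

  extend : (Carrier → WithInf Carrier) → WithInf Carrier → WithInf Carrier
  extend v (fin x) = v x
  extend v ∞       = ∞

  record IsHamelValuation (v : Carrier → WithInf Carrier) : Set (c ⊔ g ⊔ ℓ') where
    field
      v-∞-to   : ∀ x → v x ≡ ∞ → x ≡ 0#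
      v-∞-from : ∀ x → x ≡ 0# → v x ≡ ∞
      -- v(x+y) ≥₀ min₀(v x, v y)
      v-ultra  : ∀ x y → (v x ≤∞[ _<₀_ ] v (x + y)) ⊎ (v y ≤∞[ _<₀_ ] v (x + y))
      v-scale  : ∀ (λ' : K.Carrier) x → ¬ (λ' ≡ K.0#) → v (λ' · x) ≡ v x
      v-mono   : ∀ x y → 0# <₁ x → x <₁ y → v y ≤∞[ _<₀_ ] v x
      v-idem   : ∀ x → extend v (v x) ≡ v x
      v-pos    : ∀ x → fin 0# <∞[ _<₁_ ] v x

  record HamelSpace : Set (c ⊔ g ⊔ ℓ') where
    field
      v       : Carrier → WithInf Carrier
      isHamel : IsHamelValuation v

  Independent : Set (g ⊔ ℓ')
  Independent = ∀ (a₀ b₀ a₁ b₁ : WithPmInf Carrier) →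
    a₀ <±[ _<₀_ ] b₀ → a₁ <±[ _<₁_ ] b₁ →
    Σ Carrier (λ z → (a₀ <±[ _<₀_ ] val z) × (val z <±[ _<₀_ ] b₀)
                   × (a₁ <±[ _<₁_ ] val z) × (val z <±[ _<₁_ ] b₁))

-- Take z in the box. If v z ≠ z we are done; otherwise z is a fixed point of v,
-- so 0 <₁ z, and any z' in the smaller box (z, y₀) × (z, y₁) satisfies
-- v z' ≤₀ v z = z <₀ z' by monotonicity of v, hence v z' ≠ z'.
module Submission where

open import Defs
open import Data.Product using (Σ; _×_; _,_)
open import Data.Sum using (inj₁; inj₂)
open import Relation.Nullary using (¬_; Dec; yes; no)
open import Relation.Nullary.Decidable using (map′)
open import Relation.Binary.Definitions using (DecidableEquality)
open import Relation.Binary.PropositionalEquality using (_≡_; refl; cong; sym; subst; subst₂)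

module _ {a ℓ} {A : Set a} {_<_ : A → A → Set ℓ} (O : IsStrictLinearOrder A _<_) where
  open IsStrictLinearOrder O

  strictLinearOrder⇒decEq : DecidableEquality A
  strictLinearOrder⇒decEq x y with trich x y
  ... | inj₁ x<y        = no λ { refl → irrefl x x<y }
  ... | inj₂ (inj₁ x≡y) = yes x≡y
  ... | inj₂ (inj₂ y<x) = no λ { refl → irrefl x y<x }

fin-injective : ∀ {g} {A : Set g} {x y : A} → fin x ≡ fin y → x ≡ y
fin-injective refl = refl

module _ {c ℓ g ℓ'} {C : OrderedField c ℓ} {G : TwoOrderedVectorSpace C g ℓ'} (H : HamelSpace G) where
  open TwoOrderedVectorSpace G
  open HamelSpace H
  open IsHamelValuation isHamel
  private
    module O₀ = IsStrictLinearOrder <₀-isStrictLinearOrder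

  Fixed : Carrier → Set g
  Fixed z = fin z ≡ v z

  fixed? : (z : Carrier) → Dec (Fixed z)
  fixed? z with v z
  ... | ∞     = no λ ()
  ... | fin w = map′ (cong fin) fin-injective (strictLinearOrder⇒decEq <₀-isStrictLinearOrder z w)

  fixed⇒pos₁ : ∀ {z} → Fixed z → 0# <₁ z
  fixed⇒pos₁ {z} fz = subst (fin 0# <∞[ _<₁_ ]_) (sym fz) (v-pos z)

  above-fixed⇒¬fixed : ∀ {z z'} → Fixed z → z <₀ z' → z <₁ z' → ¬ Fixed z'
  above-fixed⇒¬fixed {z} {z'} fz z<₀z' z<₁z' fz'
    with subst₂ (_≤∞[ _<₀_ ]_) (sym fz') (sym fz) (v-mono z z' (fixed⇒pos₁ fz) z<₁z')
  ... | inj₁ z'<₀z = O₀.irrefl z (O₀.trans z<₀z' z'<₀z)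
  ... | inj₂ refl  = O₀.irrefl z z<₀z'

lemma4p2 : ∀ {c ℓ g ℓ'} {C : OrderedField c ℓ} (G : TwoOrderedVectorSpace C g ℓ')
    (H : HamelSpace G) → Independent G →
    let open TwoOrderedVectorSpace G
        open HamelSpace H
    in ∀ (x₀ y₀ x₁ y₁ : Carrier) → x₀ <₀ y₀ → x₁ <₁ y₁ →
       Σ Carrier (λ z → ¬ (fin z ≡ v z) × (x₀ <₀ z) × (z <₀ y₀) × (x₁ <₁ z) × (z <₁ y₁))
lemma4p2 G H ind x₀ y₀ x₁ y₁ x₀<y₀ x₁<y₁
  with ind (val x₀) (val y₀) (val x₁) (val y₁) x₀<y₀ x₁<y₁
... | z , x₀<z , z<y₀ , x₁<z , z<y₁ with fixed? H z
...   | no ¬fz = z , ¬fz , x₀<z , z<y₀ , x₁<z , z<y₁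
...   | yes fz with ind (val z) (val y₀) (val z) (val y₁) z<y₀ z<y₁
...     | z' , z<₀z' , z'<y₀ , z<₁z' , z'<y₁ =
  z' , above-fixed⇒¬fixed H fz z<₀z' z<₁z' , O₀.trans x₀<z z<₀z' , z'<y₀ , O₁.trans x₁<z z<₁z' , z'<y₁
  where
  open TwoOrderedVectorSpace G
  module O₀ = IsStrictLinearOrder <₀-isStrictLinearOrder
  module O₁ = IsStrictLinearOrder <₁-isStrictLinearOrder
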